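{- Let $I=(u..v)$ and $J=(c..d)$ be two conserved intervals of $\mathcal{P}$ with $u<c\le v<d$. Then $(u..c)$, $(c..v)$, $(v..d)$ and $(u..d)$ are conserved intervals of $\mathcal{P}$.
   Context: Let $n\ge 2$, $K\ge1$, and let $\mathcal{P}=\{P_1,\ldots,P_K\}$ be a set of signed permutations of $\{1,\ldots,n\}$: each $P_k$ is a sequence in which each of $1,\ldots,n$ appears exactly once, with a sign $+$ or $-$. Assume each $P_k$ begins with $+1$ and ends with $+n$, and $P_1=\mathrm{Id}_n$ (the identity order, all signs $+$). For $i\le j$, $(i..j)=\{i,\ldots,j\}$. A conserved interval of $\mathcal{P}$ is either a singleton, or a set $(a..c)$ with $a<c$ such that in every $P_k$ the elements of $(a..c)$ (ignoring signs) occupy consecutive positions and this block is delimited either by $+a$ on the left and $+c$ on the right, or by $-c$ on the left and $-a$ on the right. -}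

module Defs where

open import Data.Nat using (ℕ; suc; _+_; _∸_; _≤_; _<_)
open import Data.List using (List; []; _∷_; _++_; map; applyUpTo; [_])
open import Data.List.Relation.Unary.All using (All)
open import Data.List.Relation.Binary.Permutation.Propositional using (_↭_)
open import Data.Product using (_×_; _,_; proj₂; ∃-syntax)
open import Data.Sum using (_⊎_)
open import Relation.Binary.PropositionalEquality using (_≡_)

data Sign : Set where
  plus minus : Sign

SElt : Set
SElt = Sign × ℕ

SPerm : Set
SPerm = List SElt

∣_∣ₛ : SPerm → List ℕ
∣ P ∣ₛ = map proj₂ P

-- (i..j) = {i,...,j} as the list [i, i+1, ..., j] (empty if j < i)
⟦_‥_⟧ : ℕ → ℕ → List ℕ
⟦ i ‥ j ⟧ = applyUpTo (i +_) (suc j ∸ i)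

Id : ℕ → SPerm
Id n = map (λ k → plus , k) ⟦ 1 ‥ n ⟧

IsSPerm : ℕ → SPerm → Set
IsSPerm n P = (∣ P ∣ₛ ↭ ⟦ 1 ‥ n ⟧)
            × ∃[ M ] P ≡ (plus , 1) ∷ M ++ [ (plus , n) ]

ConservedIn : ℕ → ℕ → SPerm → Set
ConservedIn a c P =
  ∃[ L ] ∃[ B ] ∃[ R ] (P ≡ L ++ B ++ R) × (∣ B ∣ₛ ↭ ⟦ a ‥ c ⟧)
    × ((∃[ M ] B ≡ (plus , a) ∷ M ++ [ (plus , c) ])
       ⊎ (∃[ M ] B ≡ (minus , c) ∷ M ++ [ (minus , a) ]))

Conserved : ℕ → List SPerm → ℕ → ℕ → Set
Conserved n 𝒫 a c =
  (a ≡ c × 1 ≤ a × a ≤ n) ⊎ (a < c × All (ConservedIn a c) 𝒫)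

-- Reversing P (and flipping all signs) if necessary, the block of (u..v) reads +u … +v.
-- The blocks of (u..v) and (c..d) share the values c..v, and since u lies outside the
-- second block and d outside the first, they overlap as X Y and Y Z in P. Comparing
-- value sets, X, Y and Z carry exactly the values u..c-1, c..v and v+1..d; the
-- delimiting signs then force Y = +c … +v, X to start with +u and Z to end with +d, so
-- X +c, Y, +v Z and X Y Z are blocks witnessing the four conserved intervals.

module Submission where

open import Defs
open import Level using (0ℓ)
open import Function using (_∘_)
open import Data.Nat using (ℕ; suc; _+_; _≤_; _<_; s≤s; _≤?_)
open import Data.Nat.Properties
open import Data.List using (List; []; _∷_; _++_; _∷ʳ_; [_]; map; reverse)
open import Data.List.Properties
  using (∷-injective; ∷-injectiveˡ; ∷-injectiveʳ; ∷ʳ-injective; ++-conicalʳ; ++-assoc;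
         map-++; map-∘; map-cong; map-id; reverse-++; reverse-map; reverse-involutive)
open import Data.List.Relation.Unary.All using (All)
import Data.List.Relation.Unary.All as All
import Data.List.Relation.Unary.All.Properties as All
open import Data.List.Relation.Unary.Any using (here; there)
open import Data.List.Relation.Unary.Unique.Propositional using (Unique)
open import Data.List.Relation.Unary.Unique.Propositional.Properties using (applyUpTo⁺₁)
open import Data.List.Relation.Unary.AllPairs using ([]; _∷_)
open import Data.List.Relation.Binary.Disjoint.Propositional using (Disjoint)
open import Data.List.Membership.Propositional using (_∈_; _∉_)
open import Data.List.Membership.Propositional.Properties
  using (∈-++⁺ˡ; ∈-++⁺ʳ; ∈-++⁻; ∈-map⁺; ∈-applyUpTo⁺; ∈-applyUpTo⁻)
open import Data.List.Membership.Propositional.Properties.WithK using (unique∧set⇒bag)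
open import Data.List.Relation.Binary.BagAndSetEquality using (∼bag⇒↭)
open import Data.List.Relation.Binary.Permutation.Propositional using (_↭_; ↭-sym; ↭-trans; ↭⇒↭ₛ)
open import Data.List.Relation.Binary.Permutation.Propositional.Properties using (∈-resp-↭; ↭-reverse)
import Data.List.Relation.Binary.Permutation.Setoid.Properties as Permutation
open import Data.Product using (_×_; _,_; proj₁; proj₂; ∃-syntax)
open import Data.Sum using (_⊎_; inj₁; inj₂)
import Data.Sum as Sum
open import Data.Empty using (⊥-elim)
open import Function.Bundles using (mk⇔)
open import Relation.Nullary using (¬_; yes; no; contradiction)
open import Relation.Unary using (Pred; _⊆_; _≐_; _∪_; _∩_; _∖_; _⊥_; ｛_｝)
open import Relation.Unary.Properties using (≐-refl; ≐-sym; ≐-trans)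
open import Relation.Binary.PropositionalEquality
  using (_≡_; _≢_; refl; sym; trans; cong; subst; setoid; module ≡-Reasoning)

private variable
  A : Set
  a b c d u v x : ℕ
  e e′ : SElt
  xs ys zs : List A
  P L R B M : SPerm

++-levi : (xs ys zs ws : List A) → xs ++ ys ≡ zs ++ ws →
          (∃[ W ] zs ≡ xs ++ W × ys ≡ W ++ ws) ⊎ (∃[ W ] xs ≡ zs ++ W × ws ≡ W ++ ys)
++-levi []       ys zs       ws eq = inj₁ (zs , refl , eq)
++-levi (x ∷ xs) ys []       ws eq = inj₂ (x ∷ xs , refl , sym eq)
++-levi (x ∷ xs) ys (z ∷ zs) ws eq with refl , eq′ ← ∷-injective eq with ++-levi xs ys zs ws eq′
... | inj₁ (W , refl , ys≡) = inj₁ (W , refl , ys≡)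
... | inj₂ (W , refl , ws≡) = inj₂ (W , refl , ws≡)

∉⇒suffix : ∀ (xs : List A) {ys W S x} → x ∉ xs → xs ++ ys ≡ W ++ x ∷ S → ∃[ W′ ] ys ≡ W′ ++ x ∷ S
∉⇒suffix xs {ys} {W} {S} x∉xs eq with ++-levi xs ys W (_ ∷ S) eq
... | inj₁ (W′ , _ , ys≡)        = W′ , ys≡
... | inj₂ ([] , _ , x∷S≡)       = [] , sym x∷S≡
... | inj₂ (t ∷ T , refl , x∷S≡) = contradiction (∈-++⁺ʳ W (here (∷-injectiveˡ x∷S≡))) x∉xs

++-head : ∀ {x : A} → xs ≢ [] → xs ++ ys ≡ x ∷ zs → ∃[ xs′ ] xs ≡ x ∷ xs′
++-head {xs = []}     xs≢[] _  = ⊥-elim (xs≢[] refl)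
++-head {xs = y ∷ xs} _     eq = xs , cong (_∷ xs) (∷-injectiveˡ eq)

∷ʳ-suffix : ∀ (xs : List A) {ys zs x} → ys ≢ [] → xs ++ ys ≡ zs ∷ʳ x → ∃[ W ] ys ≡ W ∷ʳ x
∷ʳ-suffix []       {zs = zs}     _     eq = zs , eq
∷ʳ-suffix (y ∷ xs) {zs = []}     ys≢[] eq = ⊥-elim (ys≢[] (++-conicalʳ xs _ (∷-injectiveʳ eq)))
∷ʳ-suffix (y ∷ xs) {zs = z ∷ zs} ys≢[] eq = ∷ʳ-suffix xs ys≢[] (∷-injectiveʳ eq)

Unique-++⁻ : ∀ (xs : List A) → Unique (xs ++ ys) → Unique xs × Unique ys × Disjoint xs ys
Unique-++⁻ []       u        = [] , u , λ ()
Unique-++⁻ (x ∷ xs) (x∉ ∷ u) with xs! , ys! , xs#ys ← Unique-++⁻ xs u =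
  All.++⁻ˡ xs x∉ ∷ xs! , ys! , x∷xs#ys
  where
  x∷xs#ys : Disjoint (x ∷ xs) _
  x∷xs#ys (here refl , y∈ys) = All.lookup x∉ (∈-++⁺ʳ xs y∈ys) refl
  x∷xs#ys (there y∈xs , y∈ys) = xs#ys (y∈xs , y∈ys)

∪-cong : {X : Set} {A A′ B B′ : Pred X 0ℓ} → A ≐ A′ → B ≐ B′ → A ∪ B ≐ A′ ∪ B′
∪-cong (A⊆ , ⊇A) (B⊆ , ⊇B) = Sum.map A⊆ B⊆ , Sum.map ⊇A ⊇B

module Pieces {X : Set} {A B C I J : Pred X 0ℓ} (A⊥B : A ⊥ B) (A⊥C : A ⊥ C) (B⊥C : B ⊥ C)
              (A∪B≐I : A ∪ B ≐ I) (B∪C≐J : B ∪ C ≐ J) where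

  A≐I∖J : A ≐ I ∖ J
  A≐I∖J = (λ a → proj₁ A∪B≐I (inj₁ a) , λ j → A∉J a (proj₂ B∪C≐J j)) , A-of
    where
    A∉J : ∀ {x} → A x → ¬ (B ∪ C) x
    A∉J a (inj₁ b) = A⊥B (a , b)
    A∉J a (inj₂ c) = A⊥C (a , c)
    A-of : I ∖ J ⊆ A
    A-of (i , ¬j) with proj₂ A∪B≐I i
    ... | inj₁ a = a
    ... | inj₂ b = ⊥-elim (¬j (proj₁ B∪C≐J (inj₁ b)))

  B≐I∩J : B ≐ I ∩ J
  B≐I∩J = (λ b → proj₁ A∪B≐I (inj₂ b) , proj₁ B∪C≐J (inj₁ b)) , B-of
    where
    B-of : I ∩ J ⊆ B
    B-of (i , j) with proj₂ A∪B≐I i | proj₂ B∪C≐J j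
    ... | inj₂ b | _      = b
    ... | inj₁ a | inj₁ b = ⊥-elim (A⊥B (a , b))
    ... | inj₁ a | inj₂ c = ⊥-elim (A⊥C (a , c))

  C≐J∖I : C ≐ J ∖ I
  C≐J∖I = (λ c → proj₁ B∪C≐J (inj₂ c) , λ i → C∉I c (proj₂ A∪B≐I i)) , C-of
    where
    C∉I : ∀ {x} → C x → ¬ (A ∪ B) x
    C∉I c (inj₁ a) = A⊥C (a , c)
    C∉I c (inj₂ b) = B⊥C (b , c)
    C-of : J ∖ I ⊆ C
    C-of (j , ¬i) with proj₂ B∪C≐J j
    ... | inj₂ c = c
    ... | inj₁ b = ⊥-elim (¬i (proj₁ A∪B≐I (inj₂ b)))

⟨_‥_⟩ : ℕ → ℕ → Pred ℕ 0ℓ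
⟨ a ‥ b ⟩ x = a ≤ x × x ≤ b

⟦‥⟧≐⟨‥⟩ : (_∈ ⟦ a ‥ b ⟧) ≐ ⟨ a ‥ b ⟩
⟦‥⟧≐⟨‥⟩ {a} {b} = ∈⁻ , λ (a≤x , x≤b) →
  subst (_∈ ⟦ a ‥ b ⟧) (m+[n∸m]≡n a≤x) (∈-applyUpTo⁺ (a +_) (∸-monoˡ-< (s≤s x≤b) a≤x))
  where
  ∈⁻ : (_∈ ⟦ a ‥ b ⟧) ⊆ ⟨ a ‥ b ⟩
  ∈⁻ x∈ with i , i<1+b∸a , refl ← ∈-applyUpTo⁻ (a +_) x∈ =
    m≤m+n a i , subst (_≤ b) (+-comm i a) (≤-pred (m≤o∸n⇒m+n≤o (suc i) a≤1+b i<1+b∸a))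
    where
    a≤1+b : a ≤ suc b
    a≤1+b = <⇒≤ (m∸n≢0⇒n<m (λ eq → n≮0 (subst (i <_) eq i<1+b∸a)))

⟦‥⟧-unique : Unique ⟦ a ‥ b ⟧
⟦‥⟧-unique {a} = applyUpTo⁺₁ (a +_) _ (λ i<j _ → <⇒≢ i<j ∘ +-cancelˡ-≡ a _ _)

Unique-resp-↭ : {A : Set} {xs ys : List A} → xs ↭ ys → Unique xs → Unique ys
Unique-resp-↭ {A} xs↭ys = Permutation.Unique-resp-↭ (setoid A) (↭⇒↭ₛ xs↭ys)

↭⟦‥⟧⇒≐⟨‥⟩ : {xs : List ℕ} → xs ↭ ⟦ a ‥ b ⟧ → (_∈ xs) ≐ ⟨ a ‥ b ⟩
↭⟦‥⟧⇒≐⟨‥⟩ xs↭ = proj₁ ⟦‥⟧≐⟨‥⟩ ∘ ∈-resp-↭ xs↭ , ∈-resp-↭ (↭-sym xs↭) ∘ proj₂ ⟦‥⟧≐⟨‥⟩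

≐⟨‥⟩⇒↭⟦‥⟧ : {xs : List ℕ} → Unique xs → (_∈ xs) ≐ ⟨ a ‥ b ⟩ → xs ↭ ⟦ a ‥ b ⟧
≐⟨‥⟩⇒↭⟦‥⟧ xs! (xs⊆ , ⊆xs) = ∼bag⇒↭ (unique∧set⇒bag xs! ⟦‥⟧-unique
  (mk⇔ (proj₂ ⟦‥⟧≐⟨‥⟩ ∘ xs⊆) (⊆xs ∘ proj₁ ⟦‥⟧≐⟨‥⟩)))

⟨‥⟩∩⟨‥⟩ : u ≤ c → v ≤ d → ⟨ u ‥ v ⟩ ∩ ⟨ c ‥ d ⟩ ≐ ⟨ c ‥ v ⟩
⟨‥⟩∩⟨‥⟩ u≤c v≤d = (λ ((_ , x≤v) , (c≤x , _)) → c≤x , x≤v)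
                , λ (c≤x , x≤v) → (≤-trans u≤c c≤x , x≤v) , (c≤x , ≤-trans x≤v v≤d)

module _ (u≤c : u ≤ c) (c≤v : c ≤ v) (v≤d : v ≤ d) where

  ⟨‥⟩∖⟨‥⟩∪｛｝ : (⟨ u ‥ v ⟩ ∖ ⟨ c ‥ d ⟩) ∪ ｛ c ｝ ≐ ⟨ u ‥ c ⟩
  ⟨‥⟩∖⟨‥⟩∪｛｝ = to , from
    where
    to : (⟨ u ‥ v ⟩ ∖ ⟨ c ‥ d ⟩) ∪ ｛ c ｝ ⊆ ⟨ u ‥ c ⟩
    to (inj₁ ((u≤x , x≤v) , x∉J)) = u≤x , <⇒≤ (≰⇒> (λ c≤x → x∉J (c≤x , ≤-trans x≤v v≤d)))
    to (inj₂ refl)                = u≤c , ≤-refl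
    from : ⟨ u ‥ c ⟩ ⊆ (⟨ u ‥ v ⟩ ∖ ⟨ c ‥ d ⟩) ∪ ｛ c ｝
    from (u≤x , x≤c) with m≤n⇒m<n∨m≡n x≤c
    ... | inj₁ x<c  = inj₁ ((u≤x , ≤-trans (<⇒≤ x<c) c≤v) , λ (c≤x , _) → <⇒≱ x<c c≤x)
    ... | inj₂ refl = inj₂ refl

  ｛｝∪⟨‥⟩∖⟨‥⟩ : ｛ v ｝ ∪ (⟨ c ‥ d ⟩ ∖ ⟨ u ‥ v ⟩) ≐ ⟨ v ‥ d ⟩
  ｛｝∪⟨‥⟩∖⟨‥⟩ = to , from
    where
    to : ｛ v ｝ ∪ (⟨ c ‥ d ⟩ ∖ ⟨ u ‥ v ⟩) ⊆ ⟨ v ‥ d ⟩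
    to (inj₁ refl)                = ≤-refl , v≤d
    to (inj₂ ((c≤x , x≤d) , x∉I)) = <⇒≤ (≰⇒> (λ x≤v → x∉I (≤-trans u≤c c≤x , x≤v))) , x≤d
    from : ⟨ v ‥ d ⟩ ⊆ ｛ v ｝ ∪ (⟨ c ‥ d ⟩ ∖ ⟨ u ‥ v ⟩)
    from (v≤x , x≤d) with m≤n⇒m<n∨m≡n v≤x
    ... | inj₁ v<x  = inj₂ ((≤-trans c≤v (<⇒≤ v<x) , x≤d) , λ (_ , x≤v) → <⇒≱ v<x x≤v)
    ... | inj₂ refl = inj₁ refl

  ⟨‥⟩∖⟨‥⟩∪⟨‥⟩ : (⟨ u ‥ v ⟩ ∖ ⟨ c ‥ d ⟩) ∪ ⟨ c ‥ d ⟩ ≐ ⟨ u ‥ d ⟩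
  ⟨‥⟩∖⟨‥⟩∪⟨‥⟩ = to , from
    where
    to : (⟨ u ‥ v ⟩ ∖ ⟨ c ‥ d ⟩) ∪ ⟨ c ‥ d ⟩ ⊆ ⟨ u ‥ d ⟩
    to (inj₁ ((u≤x , x≤v) , _)) = u≤x , ≤-trans x≤v v≤d
    to (inj₂ (c≤x , x≤d))       = ≤-trans u≤c c≤x , x≤d
    from : ⟨ u ‥ d ⟩ ⊆ (⟨ u ‥ v ⟩ ∖ ⟨ c ‥ d ⟩) ∪ ⟨ c ‥ d ⟩
    from {x} (u≤x , x≤d) with c ≤? x
    ... | yes c≤x = inj₂ (c≤x , x≤d)
    ... | no  c≰x = inj₁ ((u≤x , ≤-trans (<⇒≤ (≰⇒> c≰x)) c≤v) , λ (c≤x , _) → c≰x c≤x)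

values : SPerm → Pred ℕ 0ℓ
values P x = x ∈ ∣ P ∣ₛ

values-++ : ∀ xs ys → values (xs ++ ys) ≐ values xs ∪ values ys
values-++ xs ys = ∈-++⁻ ∣ xs ∣ₛ ∘ subst (_ ∈_) (map-++ proj₂ xs ys)
                , subst (_ ∈_) (sym (map-++ proj₂ xs ys)) ∘ Sum.[ ∈-++⁺ˡ , ∈-++⁺ʳ ∣ xs ∣ₛ ]

values-∷ : values (e ∷ P) ≐ ｛ proj₂ e ｝ ∪ values P
values-∷ = (λ { (here refl) → inj₁ refl ; (there x∈P) → inj₂ x∈P })
         , Sum.[ (λ { refl → here refl }) , there ]

values-∷ʳ : ∀ P → values (P ∷ʳ e) ≐ values P ∪ ｛ proj₂ e ｝
values-∷ʳ P =
  ≐-trans (values-++ P [ _ ]) (∪-cong ≐-refl ((λ { (here refl) → refl }) , λ { refl → here refl }))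

values⇒≢[] : values P x → P ≢ []
values⇒≢[] () refl

Unique-∣++∣⁻ : ∀ xs → Unique ∣ xs ++ ys ∣ₛ → Unique ∣ xs ∣ₛ × Unique ∣ ys ∣ₛ × values xs ⊥ values ys
Unique-∣++∣⁻ {ys = ys} xs = Unique-++⁻ ∣ xs ∣ₛ ∘ subst Unique (map-++ proj₂ xs ys)

separated : ∀ {W B′} → Unique ∣ P ∣ₛ → P ≡ L ++ B ++ W ++ B′ ++ R → values B ⊥ values B′
separated {L = L} {B = B} {R = R} {W} {B′} P! refl (x∈B , x∈B′) =
  B#rest (x∈B , proj₂ (values-++ W (B′ ++ R)) (inj₂ (proj₂ (values-++ B′ R) (inj₁ x∈B′))))
  where
  B#rest : values B ⊥ values (W ++ B′ ++ R)
  B#rest = proj₂ (proj₂ (Unique-∣++∣⁻ B (proj₁ (proj₂ (Unique-∣++∣⁻ L P!)))))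

Delimited : ℕ → ℕ → SPerm → Set
Delimited a b B = (∃[ M ] B ≡ (plus , a) ∷ M ∷ʳ (plus , b)) ⊎ (∃[ M ] B ≡ (minus , b) ∷ M ∷ʳ (minus , a))

Delimited-from-ends : ∀ {B₁ B₂} → a ≢ b → B ≡ (plus , a) ∷ B₁ → B ≡ B₂ ∷ʳ (plus , b) → Delimited a b B
Delimited-from-ends {B₁ = []}     {B₂} a≢b refl eq =
  ⊥-elim (a≢b (cong proj₂ (proj₂ (∷ʳ-injective [] B₂ eq))))
Delimited-from-ends {B₁ = y ∷ B₁}      _   refl eq with W , B₁≡ ← ∷ʳ-suffix [ _ ] (λ ()) eq =
  inj₁ (W , cong (_ ∷_) B₁≡)

block⇒ConservedIn : Unique ∣ P ∣ₛ → P ≡ L ++ B ++ R → values B ≐ ⟨ a ‥ b ⟩ → Delimited a b B →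
                    ConservedIn a b P
block⇒ConservedIn {L = L} {B = B} P! refl B≐ B-delim =
  L , B , _ , refl , ≐⟨‥⟩⇒↭⟦‥⟧ B! B≐ , B-delim
  where
  B! : Unique ∣ B ∣ₛ
  B! = proj₁ (Unique-∣++∣⁻ B (proj₁ (proj₂ (Unique-∣++∣⁻ L P!))))

IsSPerm⇒≐ : ∀ {n} → IsSPerm n P → values P ≐ ⟨ 1 ‥ n ⟩
IsSPerm⇒≐ (P↭ , _) = ↭⟦‥⟧⇒≐⟨‥⟩ P↭

IsSPerm⇒Unique : ∀ {n} → IsSPerm n P → Unique ∣ P ∣ₛ
IsSPerm⇒Unique (P↭ , _) = Unique-resp-↭ (↭-sym P↭) ⟦‥⟧-unique

ConservedIn⇒∈ : ConservedIn a b P → a ≤ b → a ∈ ∣ P ∣ₛ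
ConservedIn⇒∈ (L , B , R , refl , B↭ , _) a≤b =
  proj₂ (values-++ L (B ++ R)) (inj₂ (proj₂ (values-++ B R) (inj₁ (proj₂ (↭⟦‥⟧⇒≐⟨‥⟩ B↭) (≤-refl , a≤b)))))

-- Reversal of signed sequences

opposite : Sign → Sign
opposite plus  = minus
opposite minus = plus

negate : SElt → SElt
negate (s , x) = opposite s , x

reverseₛ : SPerm → SPerm
reverseₛ P = reverse (map negate P)

reverseₛ-++ : ∀ xs ys → reverseₛ (xs ++ ys) ≡ reverseₛ ys ++ reverseₛ xs
reverseₛ-++ xs ys = trans (cong reverse (map-++ negate xs ys)) (reverse-++ (map negate xs) (map negate ys))

reverseₛ-involutive : ∀ P → reverseₛ (reverseₛ P) ≡ P
reverseₛ-involutive P = begin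
  reverse (map negate (reverse (map negate P))) ≡⟨ cong reverse (reverse-map negate (map negate P)) ⟩
  reverse (reverse (map negate (map negate P))) ≡⟨ reverse-involutive _ ⟩
  map negate (map negate P)                     ≡⟨ map-∘ P ⟨
  map (negate ∘ negate) P                       ≡⟨ map-cong negate-involutive P ⟩
  map (λ x → x) P                               ≡⟨ map-id P ⟩
  P                                             ∎
  where
  open ≡-Reasoning
  negate-involutive : ∀ e → negate (negate e) ≡ e
  negate-involutive (plus  , x) = refl
  negate-involutive (minus , x) = refl

∣reverseₛ∣↭ : ∀ P → ∣ reverseₛ P ∣ₛ ↭ ∣ P ∣ₛ
∣reverseₛ∣↭ P = subst (_↭ ∣ P ∣ₛ) (trans (cong reverse (map-∘ P)) (sym (reverse-map proj₂ (map negate P))))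
                      (↭-reverse ∣ P ∣ₛ)

reverseₛ-frame : ∀ M → reverseₛ (e ∷ M ∷ʳ e′) ≡ negate e′ ∷ reverseₛ M ∷ʳ negate e
reverseₛ-frame {e} {e′} M = trans (reverseₛ-++ [ e ] (M ∷ʳ e′)) (cong (_∷ʳ negate e) (reverseₛ-++ M [ e′ ]))

reverseₛ-block : ∀ L B R → reverseₛ (L ++ B ++ R) ≡ reverseₛ R ++ reverseₛ B ++ reverseₛ L
reverseₛ-block L B R = begin
  reverseₛ (L ++ B ++ R)                   ≡⟨ reverseₛ-++ L (B ++ R) ⟩
  reverseₛ (B ++ R) ++ reverseₛ L          ≡⟨ cong (_++ reverseₛ L) (reverseₛ-++ B R) ⟩
  (reverseₛ R ++ reverseₛ B) ++ reverseₛ L ≡⟨ ++-assoc (reverseₛ R) (reverseₛ B) (reverseₛ L) ⟩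
  reverseₛ R ++ reverseₛ B ++ reverseₛ L   ∎
  where open ≡-Reasoning

Unique-reverseₛ : Unique ∣ P ∣ₛ → Unique ∣ reverseₛ P ∣ₛ
Unique-reverseₛ {P} = Unique-resp-↭ (↭-sym (∣reverseₛ∣↭ P))

ConservedIn-reverseₛ : ConservedIn a b P → ConservedIn a b (reverseₛ P)
ConservedIn-reverseₛ {a} {b} (L , B , R , refl , B↭ , B-delim) =
  reverseₛ R , reverseₛ B , reverseₛ L , reverseₛ-block L B R , ↭-trans (∣reverseₛ∣↭ B) B↭ , reversed B-delim
  where
  reversed : Delimited a b B → Delimited a b (reverseₛ B)
  reversed (inj₁ (M , refl)) = inj₂ (reverseₛ M , reverseₛ-frame M)
  reversed (inj₂ (M , refl)) = inj₁ (reverseₛ M , reverseₛ-frame M)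

ConservedIn-reverseₛ⁻ : ConservedIn a b (reverseₛ P) → ConservedIn a b P
ConservedIn-reverseₛ⁻ {P = P} = subst (ConservedIn _ _) (reverseₛ-involutive P) ∘ ConservedIn-reverseₛ

PositivelyConservedIn : ℕ → ℕ → SPerm → Set
PositivelyConservedIn a b P =
  ∃[ L ] ∃[ M ] ∃[ R ] P ≡ L ++ ((plus , a) ∷ M ∷ʳ (plus , b)) ++ R
                     × ∣ (plus , a) ∷ M ∷ʳ (plus , b) ∣ₛ ↭ ⟦ a ‥ b ⟧

ConservedIn-orient : ConservedIn a b P →
                     PositivelyConservedIn a b P ⊎ PositivelyConservedIn a b (reverseₛ P)
ConservedIn-orient (L , _ , R , refl , B↭ , inj₁ (M , refl)) = inj₁ (L , M , R , refl , B↭)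
ConservedIn-orient (L , _ , R , refl , B↭ , inj₂ (M , refl)) =
  inj₂ (reverseₛ R , reverseₛ M , reverseₛ L
       , trans (reverseₛ-block L _ R) (cong (λ B → reverseₛ R ++ B ++ reverseₛ L) (reverseₛ-frame M))
       , subst (λ B → ∣ B ∣ₛ ↭ _) (reverseₛ-frame M) (↭-trans (∣reverseₛ∣↭ _) B↭))

-- Two overlapping blocks

Overlapping : SPerm → SPerm → SPerm → Set
Overlapping P B₁ B₂ =
  ∃[ L ] ∃[ X ] ∃[ Y ] ∃[ Z ] ∃[ R ] P ≡ L ++ X ++ Y ++ Z ++ R × B₁ ≡ X ++ Y × B₂ ≡ Y ++ Z

-- The two factorisations of P admit four relative layouts; all but the claimed one put v in
-- two disjoint segments, d inside B₁, or the head of B₁ inside B₂.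
blocks-overlap : ∀ {L₁ B₁ R₁ L₂ B₂ R₂} → Unique ∣ P ∣ₛ → P ≡ L₁ ++ B₁ ++ R₁ → P ≡ L₂ ++ B₂ ++ R₂ →
  (∃[ e ] ∃[ B ] B₁ ≡ e ∷ B × proj₂ e ∉ ∣ B₂ ∣ₛ) →
  v ∈ ∣ B₁ ∣ₛ → v ∈ ∣ B₂ ∣ₛ → d ∈ ∣ B₂ ∣ₛ → d ∉ ∣ B₁ ∣ₛ →
  Overlapping P B₁ B₂
blocks-overlap {L₁ = L₁} {B₁} {R₁} {L₂} {B₂} {R₂} P! eq₁ eq₂ _ v∈B₁ v∈B₂ d∈B₂ d∉B₁
  with ++-levi L₁ (B₁ ++ R₁) L₂ (B₂ ++ R₂) (trans (sym eq₁) eq₂)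
... | inj₁ (W , refl , B₁R₁≡) with ++-levi B₁ R₁ W (B₂ ++ R₂) B₁R₁≡
...   | inj₁ (W′ , refl , refl) = ⊥-elim (separated {L = L₁} {B = B₁} {W = W′} P! eq₁ (v∈B₁ , v∈B₂))
...   | inj₂ (Y , refl , B₂R₂≡) with ++-levi B₂ R₂ Y R₁ B₂R₂≡
...     | inj₁ (Z , refl , _)    =
          ⊥-elim (d∉B₁ (proj₂ (values-++ W (B₂ ++ Z)) (inj₂ (proj₂ (values-++ B₂ Z) (inj₁ d∈B₂)))))
...     | inj₂ (Z , refl , refl) =
          L₁ , W , Y , Z , R₂ , trans eq₁ (cong (L₁ ++_) (++-assoc W Y (Z ++ R₂))) , refl , refl
blocks-overlap {L₂ = L₂} {B₂ = B₂} P! eq₁ eq₂ (e , B , refl , e∉B₂) v∈B₁ v∈B₂ _ _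
  | inj₂ (W , refl , B₂R₂≡) with W′ , refl ← ∉⇒suffix _ (e∉B₂ ∘ ∈-map⁺ proj₂) B₂R₂≡ =
  ⊥-elim (separated {L = L₂} {B = B₂} {W = W′} P! eq₂ (v∈B₂ , v∈B₁))

record OverlapIntervals (u v c d : ℕ) (P : SPerm) : Set where
  field
    uc : ConservedIn u c P
    cv : c < v → ConservedIn c v P
    vd : ConservedIn v d P
    ud : ConservedIn u d P

overlap-frame : ∀ {X Y Z} → X ++ Y ≡ (plus , u) ∷ M ∷ʳ (plus , v) → Delimited c d (Y ++ Z) →
  u ∈ ∣ X ∣ₛ → v ∈ ∣ Y ∣ₛ → d ∉ ∣ Y ∣ₛ → d ∈ ∣ Z ∣ₛ →
  (∃[ X′ ] X ≡ (plus , u) ∷ X′) × (∃[ Y′ ] Y ≡ (plus , c) ∷ Y′) ×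
  (∃[ Y′ ] Y ≡ Y′ ∷ʳ (plus , v)) × (∃[ Z′ ] Z ≡ Z′ ∷ʳ (plus , d))
overlap-frame {M = M} {c = c} {d = d} {X = X} {Y} {Z} I-frame J-delim u∈X v∈Y d∉Y d∈Z =
  ++-head (values⇒≢[] u∈X) I-frame , ++-head Y≢[] J⁺ ,
  ∷ʳ-suffix X {zs = _ ∷ M} Y≢[] I-frame , ∷ʳ-suffix Y {zs = _ ∷ M′} (values⇒≢[] d∈Z) J⁺
  where
  Y≢[] : Y ≢ []
  Y≢[] = values⇒≢[] v∈Y
  positive : Delimited c d (Y ++ Z) → ∃[ M′ ] Y ++ Z ≡ (plus , c) ∷ M′ ∷ʳ (plus , d)
  positive (inj₁ J⁺)       = J⁺
  positive (inj₂ (_ , J⁻)) =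
    ⊥-elim (d∉Y (subst (λ Y → d ∈ ∣ Y ∣ₛ) (sym (proj₂ (++-head Y≢[] J⁻))) (here refl)))
  M′ : SPerm
  M′ = proj₁ (positive J-delim)
  J⁺ : Y ++ Z ≡ (plus , c) ∷ M′ ∷ʳ (plus , d)
  J⁺ = proj₂ (positive J-delim)

module _ (u<c : u < c) (c≤v : c ≤ v) (v<d : v < d) where

  private
    u≤c : u ≤ c
    u≤c = <⇒≤ u<c
    v≤d : v ≤ d
    v≤d = <⇒≤ v<d

  overlap-values : ∀ {X Y Z} → Unique ∣ L ++ X ++ Y ++ Z ++ R ∣ₛ →
    values (X ++ Y) ≐ ⟨ u ‥ v ⟩ → values (Y ++ Z) ≐ ⟨ c ‥ d ⟩ →
    values X ≐ ⟨ u ‥ v ⟩ ∖ ⟨ c ‥ d ⟩ × values Y ≐ ⟨ c ‥ v ⟩ × values Z ≐ ⟨ c ‥ d ⟩ ∖ ⟨ u ‥ v ⟩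
  overlap-values {L = L} {R = R} {X} {Y} {Z} P! I≐ J≐ =
    A≐I∖J , ≐-trans B≐I∩J (⟨‥⟩∩⟨‥⟩ u≤c v≤d) , C≐J∖I
    where
    open Pieces (separated {L = L} {B = X} {W = []} P! refl) (separated {L = L} {B = X} {W = Y} P! refl)
                (separated {L = L ++ X} {B = Y} {W = []} P! (sym (++-assoc L X (Y ++ Z ++ R))))
                (≐-trans (≐-sym (values-++ X Y)) I≐) (≐-trans (≐-sym (values-++ Y Z)) J≐)

  Overlapping⇒OverlapIntervals : ∀ {B₁ B₂} → Unique ∣ P ∣ₛ → Overlapping P B₁ B₂ →
    B₁ ≡ (plus , u) ∷ M ∷ʳ (plus , v) → values B₁ ≐ ⟨ u ‥ v ⟩ →
    Delimited c d B₂ → values B₂ ≐ ⟨ c ‥ d ⟩ → OverlapIntervals u v c d P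
  Overlapping⇒OverlapIntervals P! (L , X , Y , Z , R , refl , refl , refl) I-frame I≐ J-delim J≐
    with X≐ , Y≐ , Z≐ ← overlap-values {L = L} {R = R} P! I≐ J≐
    with (X′ , refl) , (Y₁ , refl) , (Y₂ , Y≡) , (Z′ , refl) ←
           overlap-frame {X = X} {Y = Y} {Z = Z} I-frame J-delim
             (proj₂ X≐ ((≤-refl , ≤-trans u≤c c≤v) , λ (c≤u , _) → <⇒≱ u<c c≤u))
             (proj₂ Y≐ (c≤v , ≤-refl))
             (λ d∈Y → <⇒≱ v<d (proj₂ (proj₁ Y≐ d∈Y)))
             (proj₂ Z≐ ((≤-trans c≤v v≤d , ≤-refl) , λ (_ , d≤v) → <⇒≱ v<d d≤v))
    = record
      { uc = block⇒ConservedIn P! uc-split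
               (≐-trans (values-∷ʳ X) (≐-trans (∪-cong X≐ ≐-refl) (⟨‥⟩∖⟨‥⟩∪｛｝ u≤c c≤v v≤d)))
               (inj₁ (X′ , refl))
      ; cv = λ c<v → block⇒ConservedIn P! (sym (++-assoc L X (Y ++ Z ++ R))) Y≐
                       (Delimited-from-ends (<⇒≢ c<v) refl Y≡)
      ; vd = block⇒ConservedIn P! vd-split
               (≐-trans (values-∷ {e = plus , v} {P = Z})
                        (≐-trans (∪-cong ≐-refl Z≐) (｛｝∪⟨‥⟩∖⟨‥⟩ u≤c c≤v v≤d)))
               (inj₁ (Z′ , refl))
      ; ud = block⇒ConservedIn P! ud-split
               (≐-trans (values-++ X (Y ++ Z)) (≐-trans (∪-cong X≐ J≐) (⟨‥⟩∖⟨‥⟩∪⟨‥⟩ u≤c c≤v v≤d)))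
               (inj₁ (X′ ++ Y ++ Z′ , cong (_ ∷_) ud-frame))
      }
    where
    open ≡-Reasoning
    uc-split : L ++ X ++ Y ++ Z ++ R ≡ L ++ (X ∷ʳ (plus , c)) ++ Y₁ ++ Z ++ R
    uc-split = cong (L ++_) (sym (++-assoc X [ _ ] (Y₁ ++ Z ++ R)))
    vd-split : L ++ X ++ Y ++ Z ++ R ≡ (L ++ X ++ Y₂) ++ ((plus , v) ∷ Z) ++ R
    vd-split = begin
      L ++ X ++ Y ++ Z ++ R                   ≡⟨ cong (λ Y → L ++ X ++ Y ++ Z ++ R) Y≡ ⟩
      L ++ X ++ (Y₂ ∷ʳ (plus , v)) ++ Z ++ R  ≡⟨ cong (λ W → L ++ X ++ W) (++-assoc Y₂ [ _ ] (Z ++ R)) ⟩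
      L ++ X ++ Y₂ ++ (plus , v) ∷ Z ++ R     ≡⟨ cong (L ++_) (++-assoc X Y₂ _) ⟨
      L ++ (X ++ Y₂) ++ (plus , v) ∷ Z ++ R   ≡⟨ ++-assoc L (X ++ Y₂) _ ⟨
      (L ++ X ++ Y₂) ++ (plus , v) ∷ Z ++ R   ∎
    ud-split : L ++ X ++ Y ++ Z ++ R ≡ L ++ (X ++ Y ++ Z) ++ R
    ud-split = cong (L ++_) (sym (trans (++-assoc X (Y ++ Z) R) (cong (X ++_) (++-assoc Y Z R))))
    ud-frame : X′ ++ Y ++ Z′ ∷ʳ (plus , d) ≡ (X′ ++ Y ++ Z′) ∷ʳ (plus , d)
    ud-frame = sym (trans (++-assoc X′ (Y ++ Z′) _) (cong (X′ ++_) (++-assoc Y Z′ _)))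

  overlapIntervals⁺ : Unique ∣ P ∣ₛ → PositivelyConservedIn u v P → ConservedIn c d P →
                      OverlapIntervals u v c d P
  overlapIntervals⁺ {P = P} P! (L₁ , M , R₁ , eq₁ , I↭) (L₂ , B₂ , R₂ , eq₂ , J↭ , J-delim) =
    Overlapping⇒OverlapIntervals P! I∣J refl I≐ J-delim J≐
    where
    u≤v : u ≤ v
    u≤v = ≤-trans u≤c c≤v
    c≤d : c ≤ d
    c≤d = ≤-trans c≤v v≤d
    I≐ : values ((plus , u) ∷ M ∷ʳ (plus , v)) ≐ ⟨ u ‥ v ⟩
    I≐ = ↭⟦‥⟧⇒≐⟨‥⟩ I↭
    J≐ : values B₂ ≐ ⟨ c ‥ d ⟩
    J≐ = ↭⟦‥⟧⇒≐⟨‥⟩ J↭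
    u∉J : u ∉ ∣ B₂ ∣ₛ
    u∉J u∈J = <⇒≱ u<c (proj₁ (proj₁ J≐ u∈J))
    d∉I : d ∉ ∣ (plus , u) ∷ M ∷ʳ (plus , v) ∣ₛ
    d∉I d∈I = <⇒≱ v<d (proj₂ (proj₁ I≐ d∈I))
    I∣J : Overlapping P ((plus , u) ∷ M ∷ʳ (plus , v)) B₂
    I∣J = blocks-overlap {L₁ = L₁} {R₁ = R₁} {L₂ = L₂} {R₂ = R₂} P! eq₁ eq₂ (_ , _ , refl , u∉J)
            (proj₂ I≐ (u≤v , ≤-refl)) (proj₂ J≐ (c≤v , v≤d)) (proj₂ J≐ (c≤d , ≤-refl)) d∉I

  overlapIntervals : Unique ∣ P ∣ₛ → ConservedIn u v P → ConservedIn c d P →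
                     OverlapIntervals u v c d P
  overlapIntervals {P = P} P! I J with ConservedIn-orient I
  ... | inj₁ I⁺ = overlapIntervals⁺ P! I⁺ J
  ... | inj₂ I⁺ = unreverse (overlapIntervals⁺ (Unique-reverseₛ P!) I⁺ (ConservedIn-reverseₛ J))
    where
    unreverse : OverlapIntervals u v c d (reverseₛ P) → OverlapIntervals u v c d P
    unreverse o = record
      { uc = ConservedIn-reverseₛ⁻ uc ; cv = ConservedIn-reverseₛ⁻ ∘ cv
      ; vd = ConservedIn-reverseₛ⁻ vd ; ud = ConservedIn-reverseₛ⁻ ud }
      where open OverlapIntervals o

lemma5 : (n : ℕ) → 2 ≤ n → (Ps : List SPerm) →
         All (IsSPerm n) (Id n ∷ Ps) →
         (u v c d : ℕ) →
         Conserved n (Id n ∷ Ps) u v → Conserved n (Id n ∷ Ps) c d →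
         u < c → c ≤ v → v < d →
         Conserved n (Id n ∷ Ps) u c × Conserved n (Id n ∷ Ps) c v
           × Conserved n (Id n ∷ Ps) v d × Conserved n (Id n ∷ Ps) u d
lemma5 n _ Ps perms u v c d (inj₁ (refl , _)) _ u<c c≤v v<d = ⊥-elim (<⇒≱ u<c c≤v)
lemma5 n _ Ps perms u v c d _ (inj₁ (refl , _)) u<c c≤v v<d = ⊥-elim (<⇒≱ v<d c≤v)
lemma5 n _ Ps perms u v c d (inj₂ (_ , I)) (inj₂ (c<d , J)) u<c c≤v v<d =
  inj₂ (u<c , All.map uc overlaps) , conserved-cv , inj₂ (v<d , All.map vd overlaps) ,
  inj₂ (<-trans u<c (≤-<-trans c≤v v<d) , All.map ud overlaps)
  where
  open OverlapIntervals
  overlaps : All (OverlapIntervals u v c d) (Id n ∷ Ps)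
  overlaps = All.zipWith (λ (perm , I , J) → overlapIntervals u<c c≤v v<d (IsSPerm⇒Unique perm) I J)
                         (perms , All.zip (I , J))
  conserved-cv : Conserved n (Id n ∷ Ps) c v
  conserved-cv with m≤n⇒m<n∨m≡n c≤v
  ... | inj₁ c<v  = inj₂ (c<v , All.map (λ o → cv o c<v) overlaps)
  ... | inj₂ refl = inj₁ (refl , proj₁ (IsSPerm⇒≐ (All.head perms)) (ConservedIn⇒∈ (All.head J) (<⇒≤ c<d)))
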